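{- $\mathsf{HA}$ proves every axiom of $\mathsf{HA}^\exists$ (i.e. $\mathsf{HA}\vdash\mathsf{HA}^\exists$). Consequently, every formula provable in $\mathsf{HA}^\exists$ is provable in $\mathsf{HA}$.
   Context: $\mathsf{HA}$ is Heyting Arithmetic (intuitionistic logic, axioms for equality, successor, addition, multiplication, and the induction scheme $P(0)\wedge\forall\alpha(P(\alpha)\to P(\alpha+1))\to\forall\alpha P(\alpha)$ for all formulas $P$). The $\exists$-translation $F^\exists$ is defined by: $F^\exists=F$ for atomic $F$; $(F_1\wedge F_2)^\exists=F_1^\exists\wedge F_2^\exists$; $(F_1\vee F_2)^\exists=F_1^\exists\vee F_2^\exists$; $(F_1\to F_2)^\exists=F_1^\exists\to F_2^\exists$; $(\forall xF)^\exists=\neg\exists x\,\neg F^\exists$; $(\exists xF)^\exists=\exists x\,F^\exists$, with $\neg A:=A\to\bot$. $\mathsf{HA}^\exists$ is the intuitionistic theory whose axioms are the $\exists$-translations of the axioms of $\mathsf{HA}$; in particular its induction axioms read $P(0)\wedge\neg\exists\alpha\,\neg(P(\alpha)\to P(\alpha+1))\to\neg\exists\alpha\,\neg P(\alpha)$. -}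

module Defs where

open import Data.Nat using (ℕ; zero; suc)
open import Data.List using (List; _∷_; []; map)
open import Data.List.Membership.Propositional using (_∈_)

infixl 7 _⊗_
infixl 6 _⊕_
infix  4 _≐_
infixr 3 _∧'_
infixr 2 _∨'_
infixr 1 _⇒_

-- Syntax of first-order arithmetic (de Bruijn variables)

data Term : Set where
  var : ℕ → Term
  Z   : Term
  S   : Term → Term
  _⊕_ : Term → Term → Term
  _⊗_ : Term → Term → Term

data Formula : Set where
  _≐_  : Term → Term → Formula
  ⊥'   : Formula
  _∧'_ : Formula → Formula → Formula
  _∨'_ : Formula → Formula → Formula
  _⇒_  : Formula → Formula → Formula
  ∀'   : Formula → Formula         -- binds variable 0
  ∃'   : Formula → Formula         -- binds variable 0

¬' : Formula → Formula
¬' A = A ⇒ ⊥'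

Ren : Set
Ren = ℕ → ℕ

Sub : Set
Sub = ℕ → Term

liftR : Ren → Ren
liftR ρ zero    = zero
liftR ρ (suc n) = suc (ρ n)

renT : Ren → Term → Term
renT ρ (var n) = var (ρ n)
renT ρ Z       = Z
renT ρ (S t)   = S (renT ρ t)
renT ρ (s ⊕ t) = renT ρ s ⊕ renT ρ t
renT ρ (s ⊗ t) = renT ρ s ⊗ renT ρ t

ren : Ren → Formula → Formula
ren ρ (s ≐ t)  = renT ρ s ≐ renT ρ t
ren ρ ⊥'       = ⊥'
ren ρ (A ∧' B) = ren ρ A ∧' ren ρ B
ren ρ (A ∨' B) = ren ρ A ∨' ren ρ B
ren ρ (A ⇒ B)  = ren ρ A ⇒ ren ρ B
ren ρ (∀' A)   = ∀' (ren (liftR ρ) A)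
ren ρ (∃' A)   = ∃' (ren (liftR ρ) A)

liftS : Sub → Sub
liftS σ zero    = var zero
liftS σ (suc n) = renT suc (σ n)

subT : Sub → Term → Term
subT σ (var n) = σ n
subT σ Z       = Z
subT σ (S t)   = S (subT σ t)
subT σ (s ⊕ t) = subT σ s ⊕ subT σ t
subT σ (s ⊗ t) = subT σ s ⊗ subT σ t

sub : Sub → Formula → Formula
sub σ (s ≐ t)  = subT σ s ≐ subT σ t
sub σ ⊥'       = ⊥'
sub σ (A ∧' B) = sub σ A ∧' sub σ B
sub σ (A ∨' B) = sub σ A ∨' sub σ B
sub σ (A ⇒ B)  = sub σ A ⇒ sub σ B
sub σ (∀' A)   = ∀' (sub (liftS σ) A)
sub σ (∃' A)   = ∃' (sub (liftS σ) A)

↑ : Formula → Formula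
↑ = ren suc

-- A [ t ] : instantiate variable 0 by t (and lower the others)
single : Term → Sub
single t zero    = t
single t (suc n) = var n

_[_] : Formula → Term → Formula
A [ t ] = sub (single t) A

succSub : Sub
succSub zero    = S (var zero)
succSub (suc n) = var (suc n)

-- Intuitionistic natural deduction over an axiom set Ax
-- (axioms may be open formulas; free variables are shared with context)

Context : Set
Context = List Formula

data Pf (Ax : Formula → Set) (Γ : Context) : Formula → Set where
  hyp  : ∀ {A} → A ∈ Γ → Pf Ax Γ A
  ax   : ∀ {A} → Ax A → Pf Ax Γ A
  ⊥E   : ∀ {A} → Pf Ax Γ ⊥' → Pf Ax Γ A
  ∧I   : ∀ {A B} → Pf Ax Γ A → Pf Ax Γ B → Pf Ax Γ (A ∧' B)
  ∧E₁  : ∀ {A B} → Pf Ax Γ (A ∧' B) → Pf Ax Γ A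
  ∧E₂  : ∀ {A B} → Pf Ax Γ (A ∧' B) → Pf Ax Γ B
  ∨I₁  : ∀ {A B} → Pf Ax Γ A → Pf Ax Γ (A ∨' B)
  ∨I₂  : ∀ {A B} → Pf Ax Γ B → Pf Ax Γ (A ∨' B)
  ∨E   : ∀ {A B C} → Pf Ax Γ (A ∨' B) → Pf Ax (A ∷ Γ) C → Pf Ax (B ∷ Γ) C → Pf Ax Γ C
  ⇒I   : ∀ {A B} → Pf Ax (A ∷ Γ) B → Pf Ax Γ (A ⇒ B)
  ⇒E   : ∀ {A B} → Pf Ax Γ (A ⇒ B) → Pf Ax Γ A → Pf Ax Γ B
  ∀I   : ∀ {A} → Pf Ax (map ↑ Γ) A → Pf Ax Γ (∀' A)
  ∀E   : ∀ {A} → Pf Ax Γ (∀' A) → (t : Term) → Pf Ax Γ (A [ t ])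
  ∃I   : ∀ {A} → (t : Term) → Pf Ax Γ (A [ t ]) → Pf Ax Γ (∃' A)
  ∃E   : ∀ {A C} → Pf Ax Γ (∃' A) → Pf Ax (A ∷ map ↑ Γ) (↑ C) → Pf Ax Γ C

_⊢_ : (Formula → Set) → Formula → Set
T ⊢ A = Pf T [] A

-- Axioms of HA (schematic in terms, so closed under substitution)

data HA-Ax : Formula → Set where
  eq-refl  : ∀ t → HA-Ax (t ≐ t)
  eq-sym   : ∀ s t → HA-Ax (s ≐ t ⇒ t ≐ s)
  eq-trans : ∀ r s t → HA-Ax (r ≐ s ⇒ s ≐ t ⇒ r ≐ t)
  eq-S     : ∀ s t → HA-Ax (s ≐ t ⇒ S s ≐ S t)
  eq-⊕     : ∀ s s' t t' → HA-Ax (s ≐ s' ⇒ t ≐ t' ⇒ (s ⊕ t) ≐ (s' ⊕ t'))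
  eq-⊗     : ∀ s s' t t' → HA-Ax (s ≐ s' ⇒ t ≐ t' ⇒ (s ⊗ t) ≐ (s' ⊗ t'))
  S-nz     : ∀ t → HA-Ax (¬' (S t ≐ Z))
  S-inj    : ∀ s t → HA-Ax (S s ≐ S t ⇒ s ≐ t)
  ⊕-Z      : ∀ t → HA-Ax ((t ⊕ Z) ≐ t)
  ⊕-S      : ∀ s t → HA-Ax ((s ⊕ S t) ≐ S (s ⊕ t))
  ⊗-Z      : ∀ t → HA-Ax ((t ⊗ Z) ≐ Z)
  ⊗-S      : ∀ s t → HA-Ax ((s ⊗ S t) ≐ ((s ⊗ t) ⊕ s))
  -- induction: P(0) ∧ ∀α (P(α) → P(α+1)) → ∀α P(α), α = variable 0
  ind      : ∀ P → HA-Ax ((P [ Z ]) ∧' ∀' (P ⇒ sub succSub P) ⇒ ∀' P)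

_∃ᵗ : Formula → Formula
(s ≐ t) ∃ᵗ  = s ≐ t
⊥' ∃ᵗ       = ⊥'
(A ∧' B) ∃ᵗ = (A ∃ᵗ) ∧' (B ∃ᵗ)
(A ∨' B) ∃ᵗ = (A ∃ᵗ) ∨' (B ∃ᵗ)
(A ⇒ B) ∃ᵗ  = (A ∃ᵗ) ⇒ (B ∃ᵗ)
(∀' A) ∃ᵗ   = ¬' (∃' (¬' (A ∃ᵗ)))
(∃' A) ∃ᵗ   = ∃' (A ∃ᵗ)

data HA∃-Ax : Formula → Set where
  tr : ∀ {A} → HA-Ax A → HA∃-Ax (A ∃ᵗ)

-- The quantifier-free axioms of HA are their own ∃-translations, so the only
-- work is the translated induction scheme for P := Q ∃ᵗ. HA proves it by
-- induction on ¬¬Q: the hypothesis ¬∃α¬(Q(α) → Q(α+1)) gives ¬¬(Q(α) → Q(α+1))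
-- for every α, hence ¬¬Q(α) → ¬¬Q(α+1); induction yields ∀α ¬¬Q(α), which
-- refutes ∃α ¬Q(α). Derivations of HA∃ then become derivations of HA by
-- replacing each axiom with its HA-proof.
module Submission where

open import Defs
open import Data.Product using (_×_; _,_)
open import Data.Nat using (zero; suc)
open import Data.List using (_∷_)
open import Data.List.Relation.Unary.Any using (here; there)
open import Relation.Binary.PropositionalEquality using (_≡_; refl; sym; cong; cong₂; subst)

subT-renT-inverse : ∀ σ ρ → (∀ n → σ (ρ n) ≡ var n) → ∀ t → subT σ (renT ρ t) ≡ t
subT-renT-inverse σ ρ inv (var n) = inv n
subT-renT-inverse σ ρ inv Z       = refl
subT-renT-inverse σ ρ inv (S t)   = cong S (subT-renT-inverse σ ρ inv t)
subT-renT-inverse σ ρ inv (s ⊕ t) = cong₂ _⊕_ (subT-renT-inverse σ ρ inv s) (subT-renT-inverse σ ρ inv t)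
subT-renT-inverse σ ρ inv (s ⊗ t) = cong₂ _⊗_ (subT-renT-inverse σ ρ inv s) (subT-renT-inverse σ ρ inv t)

liftS-liftR-inverse : ∀ σ ρ → (∀ n → σ (ρ n) ≡ var n) → ∀ n → liftS σ (liftR ρ n) ≡ var n
liftS-liftR-inverse σ ρ inv zero    = refl
liftS-liftR-inverse σ ρ inv (suc n) = cong (renT suc) (inv n)

sub-ren-inverse : ∀ σ ρ → (∀ n → σ (ρ n) ≡ var n) → ∀ A → sub σ (ren ρ A) ≡ A
sub-ren-inverse σ ρ inv (s ≐ t)  = cong₂ _≐_ (subT-renT-inverse σ ρ inv s) (subT-renT-inverse σ ρ inv t)
sub-ren-inverse σ ρ inv ⊥'       = refl
sub-ren-inverse σ ρ inv (A ∧' B) = cong₂ _∧'_ (sub-ren-inverse σ ρ inv A) (sub-ren-inverse σ ρ inv B)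
sub-ren-inverse σ ρ inv (A ∨' B) = cong₂ _∨'_ (sub-ren-inverse σ ρ inv A) (sub-ren-inverse σ ρ inv B)
sub-ren-inverse σ ρ inv (A ⇒ B)  = cong₂ _⇒_ (sub-ren-inverse σ ρ inv A) (sub-ren-inverse σ ρ inv B)
sub-ren-inverse σ ρ inv (∀' A)   = cong ∀' (sub-ren-inverse _ _ (liftS-liftR-inverse σ ρ inv) A)
sub-ren-inverse σ ρ inv (∃' A)   = cong ∃' (sub-ren-inverse _ _ (liftS-liftR-inverse σ ρ inv) A)

-- ren (liftR suc) A is the body of ↑ (∀' A): instantiating its bound variable
-- by var 0 recovers A.
↑-under-binder-[var0] : ∀ A → ren (liftR suc) A [ var 0 ] ≡ A
↑-under-binder-[var0] = sub-ren-inverse _ _ λ { zero → refl ; (suc n) → refl }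

∃ᵗ-sub : ∀ σ A → (sub σ A) ∃ᵗ ≡ sub σ (A ∃ᵗ)
∃ᵗ-sub σ (s ≐ t)  = refl
∃ᵗ-sub σ ⊥'       = refl
∃ᵗ-sub σ (A ∧' B) = cong₂ _∧'_ (∃ᵗ-sub σ A) (∃ᵗ-sub σ B)
∃ᵗ-sub σ (A ∨' B) = cong₂ _∨'_ (∃ᵗ-sub σ A) (∃ᵗ-sub σ B)
∃ᵗ-sub σ (A ⇒ B)  = cong₂ _⇒_ (∃ᵗ-sub σ A) (∃ᵗ-sub σ B)
∃ᵗ-sub σ (∀' A)   = cong (λ X → ¬' (∃' (¬' X))) (∃ᵗ-sub (liftS σ) A)
∃ᵗ-sub σ (∃' A)   = cong ∃' (∃ᵗ-sub (liftS σ) A)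

module _ {Ax : Formula → Set} where

  private
    #0 : ∀ {Γ A} → Pf Ax (A ∷ Γ) A
    #0 = hyp (here refl)

    #1 : ∀ {Γ A B} → Pf Ax (B ∷ A ∷ Γ) A
    #1 = hyp (there (here refl))

    #2 : ∀ {Γ A B C} → Pf Ax (C ∷ B ∷ A ∷ Γ) A
    #2 = hyp (there (there (here refl)))

  ¬¬-intro : ∀ {Γ A} → Pf Ax Γ (A ⇒ ¬' (¬' A))
  ¬¬-intro = ⇒I (⇒I (⇒E #0 #1))

  ¬¬-⇒ : ∀ {Γ A B} → Pf Ax Γ (¬' (¬' (A ⇒ B)) ⇒ ¬' (¬' A) ⇒ ¬' (¬' B))
  ¬¬-⇒ = ⇒I (⇒I (⇒I (⇒E #1 (⇒I (⇒E #3 (⇒I (⇒E #2 (⇒E #0 #1))))))))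
    where
    #3 : ∀ {Γ A B C D} → Pf Ax (D ∷ C ∷ B ∷ A ∷ Γ) A
    #3 = hyp (there (there (there (here refl))))

  ¬∃¬⇒¬¬ : ∀ {Γ A} → Pf Ax Γ (¬' (∃' (¬' (ren (liftR suc) A))) ⇒ ¬' (¬' A))
  ¬∃¬⇒¬¬ {A = A} =
    ⇒I (⇒I (⇒E #1 (∃I (var 0) (subst (Pf Ax _) (sym (↑-under-binder-[var0] (¬' A))) #0))))

  ∀¬¬⇒¬∃¬ : ∀ {Γ A} → Pf Ax Γ (∀' (¬' (¬' A)) ⇒ ¬' (∃' (¬' A)))
  ∀¬¬⇒¬∃¬ {A = A} =
    ⇒I (⇒I (∃E #0 (⇒E (subst (Pf Ax _) (↑-under-binder-[var0] (¬' (¬' A))) (∀E #2 (var 0))) #0)))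

  replaceAxioms : ∀ {Ax′ : Formula → Set} → (∀ {Γ A} → Ax A → Pf Ax′ Γ A) →
                  ∀ {Γ F} → Pf Ax Γ F → Pf Ax′ Γ F
  replaceAxioms prove (hyp x)    = hyp x
  replaceAxioms prove (ax a)     = prove a
  replaceAxioms prove (⊥E p)     = ⊥E (replaceAxioms prove p)
  replaceAxioms prove (∧I p q)   = ∧I (replaceAxioms prove p) (replaceAxioms prove q)
  replaceAxioms prove (∧E₁ p)    = ∧E₁ (replaceAxioms prove p)
  replaceAxioms prove (∧E₂ p)    = ∧E₂ (replaceAxioms prove p)
  replaceAxioms prove (∨I₁ p)    = ∨I₁ (replaceAxioms prove p)
  replaceAxioms prove (∨I₂ p)    = ∨I₂ (replaceAxioms prove p)
  replaceAxioms prove (∨E p q r) = ∨E (replaceAxioms prove p) (replaceAxioms prove q) (replaceAxioms prove r)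
  replaceAxioms prove (⇒I p)     = ⇒I (replaceAxioms prove p)
  replaceAxioms prove (⇒E p q)   = ⇒E (replaceAxioms prove p) (replaceAxioms prove q)
  replaceAxioms prove (∀I p)     = ∀I (replaceAxioms prove p)
  replaceAxioms prove (∀E p t)   = ∀E (replaceAxioms prove p) t
  replaceAxioms prove (∃I t p)   = ∃I t (replaceAxioms prove p)
  replaceAxioms prove (∃E p q)   = ∃E (replaceAxioms prove p) (replaceAxioms prove q)

HA⊢ind∃ : ∀ {Γ} Q →
          Pf HA-Ax Γ (Q [ Z ] ∧' ¬' (∃' (¬' (Q ⇒ sub succSub Q))) ⇒ ¬' (∃' (¬' Q)))
HA⊢ind∃ {Γ} Q = ⇒I (⇒E ∀¬¬⇒¬∃¬ (⇒E (ax (ind (¬' (¬' Q)))) (∧I base step)))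
  where
  H = Q [ Z ] ∧' ¬' (∃' (¬' (Q ⇒ sub succSub Q)))

  base : Pf HA-Ax (H ∷ Γ) (¬' (¬' (Q [ Z ])))
  base = ⇒E ¬¬-intro (∧E₁ (hyp (here refl)))

  step : Pf HA-Ax (H ∷ Γ) (∀' (¬' (¬' Q) ⇒ ¬' (¬' (sub succSub Q))))
  step = ∀I (⇒E ¬¬-⇒ (⇒E ¬∃¬⇒¬¬ (∧E₂ (hyp (here refl)))))

HA⊢HA∃-Ax : ∀ {Γ A} → HA∃-Ax A → Pf HA-Ax Γ A
HA⊢HA∃-Ax (tr (ind P)) rewrite ∃ᵗ-sub (single Z) P | ∃ᵗ-sub succSub P = HA⊢ind∃ (P ∃ᵗ)
HA⊢HA∃-Ax (tr (eq-refl t))       = ax (eq-refl t)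
HA⊢HA∃-Ax (tr (eq-sym s t))      = ax (eq-sym s t)
HA⊢HA∃-Ax (tr (eq-trans r s t))  = ax (eq-trans r s t)
HA⊢HA∃-Ax (tr (eq-S s t))        = ax (eq-S s t)
HA⊢HA∃-Ax (tr (eq-⊕ s s′ t t′))  = ax (eq-⊕ s s′ t t′)
HA⊢HA∃-Ax (tr (eq-⊗ s s′ t t′))  = ax (eq-⊗ s s′ t t′)
HA⊢HA∃-Ax (tr (S-nz t))          = ax (S-nz t)
HA⊢HA∃-Ax (tr (S-inj s t))       = ax (S-inj s t)
HA⊢HA∃-Ax (tr (⊕-Z t))           = ax (⊕-Z t)
HA⊢HA∃-Ax (tr (⊕-S s t))         = ax (⊕-S s t)
HA⊢HA∃-Ax (tr (⊗-Z t))           = ax (⊗-Z t)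
HA⊢HA∃-Ax (tr (⊗-S s t))         = ax (⊗-S s t)

mainTheorem9 : ((A : Formula) → HA∃-Ax A → HA-Ax ⊢ A)
    × ((F : Formula) → HA∃-Ax ⊢ F → HA-Ax ⊢ F)
mainTheorem9 = (λ A → HA⊢HA∃-Ax) , (λ F → replaceAxioms HA⊢HA∃-Ax)
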